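{- Let $D=(V,A)$ be a connected directed multigraph, $c_l,c_u:A\to\mathbb{Z}$, $\Delta\in\mathbb{Z}^{\mathcal{C}}$, such that $\mathcal{B}_\Delta(D,c_l,c_u)$ is non-empty and no arc is rigid, and fix $v_0\in V$. Color each arc $(x,y)$ of the cover graph of the poset $\mathcal{P}_\Delta=(\mathcal{B}_\Delta(D,c_l,c_u),\le)$ by the vertex $v\in V\setminus\{v_0\}$ with $y=\mathrm{push}(\{v\},x)$. This coloring is a U-coloring.
   Context: $\mathcal{C}$ is the set of cycles of $D$ (cycles of the underlying undirected graph, each with a prescribed direction); $C^\pm$ are the arcs traversed forward/backward; $\delta(C,x)=\sum_{a\in C^+}x(a)-\sum_{a\in C^- }x(a)$. A $\Delta$-bond is $x:A\to\mathbb{Z}$ with $c_l\le x\le c_u$ arcwise and $\delta(C,x)=\Delta_C$ for all $C$; $\mathcal{B}_\Delta(D,c_l,c_u)$ is their set. An arc $a$ is rigid if $x(a)=y(a)$ for all $\Delta$-bonds $x,y$. For $U\subseteq V$, $\mathrm{push}(U,x)$ adds $1$ on arcs from $U$ to $V\setminus U$, subtracts $1$ on arcs from $V\setminus U$ to $U$ and is unchanged elsewhere. For $\Delta$-bonds, $x\le y$ means $y$ is reached from $x$ by a sequence of pushes at sets $U_i$ with $v_0\notin U_i$, all intermediate maps being $\Delta$-bonds; this is a partial order, and every cover relation $x\prec y$ is of the form $y=\mathrm{push}(\{v\},x)$ for a vertex $v\neq v_0$. For a digraph, an arc coloring $c$ is a U-coloring if for all $u,v,w$ with $u\neq w$ and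 arcs $(v,u),(v,w)$: (U$_1$) $c(v,u)\neq c(v,w)$; (U$_2$) there is $z$ with arcs $(u,z),(w,z)$ such that $c(v,u)=c(w,z)$ and $c(v,w)=c(u,z)$. -}

module Defs where

open import Data.Nat using (ℕ)
open import Data.Fin using (Fin; _≟_)
open import Data.Bool using (Bool; true; false; if_then_else_)
open import Data.Integer using (ℤ; _+_; _-_; _≤_; 0ℤ; 1ℤ; -1ℤ)
open import Data.List using (List; []; _∷_; map; foldr)
open import Data.List.Relation.Unary.Unique.Propositional using (Unique)
open import Data.Product using (Σ; Σ-syntax; ∃; _×_; _,_; proj₁; proj₂)
open import Data.Sum using (_⊎_)
open import Relation.Nullary using (¬_)
open import Relation.Nullary.Decidable using (⌊_⌋)
open import Relation.Binary.PropositionalEquality using (_≡_; _≢_)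
open import Relation.Binary.Construct.Closure.ReflexiveTransitive using (Star)

-- Directed multigraph D = (V, A) with V = Fin n, A = Fin m,
-- arc a goes from (src a) to (tgt a).  Parallel arcs / loops allowed.

module _ {n m : ℕ} (src tgt : Fin m → Fin n) where

  UAdj : Fin n → Fin n → Set
  UAdj u v = Σ[ a ∈ Fin m ] ((src a ≡ u × tgt a ≡ v) ⊎ (src a ≡ v × tgt a ≡ u))

  Connected : Set
  Connected = ∀ (u v : Fin n) → Star UAdj u v

  -- A traversal step: an arc with a direction (true = forward, false = backward)
  TStep : Set
  TStep = Fin m × Bool

  start : TStep → Fin n
  start (a , true)  = src a
  start (a , false) = tgt a

  end : TStep → Fin n
  end (a , true)  = tgt a
  end (a , false) = src a

  Walk : Fin n → List TStep → Fin n → Set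
  Walk u []       v = u ≡ v
  Walk u (s ∷ ss) v = (start s ≡ u) × Walk (end s) ss v

  -- Arcs traversed forward form C⁺, backward form C⁻.
  record Cycle : Set where
    constructor mkCycle
    field
      first     : TStep
      rest      : List TStep
      closed    : Walk (start first) (first ∷ rest) (start first)
      distinctV : Unique (map start (first ∷ rest))
      distinctA : Unique (map proj₁ (first ∷ rest))

  steps : Cycle → List TStep
  steps C = Cycle.first C ∷ Cycle.rest C

  δ : Cycle → (Fin m → ℤ) → ℤ
  δ C x = foldr (λ s acc → contrib s + acc) 0ℤ (steps C)
    where
      contrib : TStep → ℤ
      contrib (a , true)  = x a
      contrib (a , false) = 0ℤ - x a

  IsBond : (cl cu : Fin m → ℤ) (Δ : Cycle → ℤ) → (Fin m → ℤ) → Set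
  IsBond cl cu Δ x = (∀ a → (cl a ≤ x a) × (x a ≤ cu a)) × (∀ C → δ C x ≡ Δ C)

  Bond : (cl cu : Fin m → ℤ) (Δ : Cycle → ℤ) → Set
  Bond cl cu Δ = Σ (Fin m → ℤ) (IsBond cl cu Δ)

  Rigid : (cl cu : Fin m → ℤ) (Δ : Cycle → ℤ) → Fin m → Set
  Rigid cl cu Δ a = ∀ (x y : Bond cl cu Δ) → proj₁ x a ≡ proj₁ y a

  push : (Fin n → Bool) → (Fin m → ℤ) → (Fin m → ℤ)
  push U x a with U (src a) | U (tgt a)
  ... | true  | false = x a + 1ℤ
  ... | false | true  = x a + -1ℤ
  ... | _     | _     = x a

  singleton : Fin n → (Fin n → Bool)
  singleton v u = ⌊ u ≟ v ⌋

  _≈_ : (Fin m → ℤ) → (Fin m → ℤ) → Set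
  x ≈ y = ∀ a → x a ≡ y a

  module _ (cl cu : Fin m → ℤ) (Δ : Cycle → ℤ) (v₀ : Fin n) where

    PushStep : Bond cl cu Δ → Bond cl cu Δ → Set
    PushStep x y = Σ[ U ∈ (Fin n → Bool) ] (U v₀ ≡ false) × (proj₁ y ≈ push U (proj₁ x))

    _≤P_ : Bond cl cu Δ → Bond cl cu Δ → Set
    x ≤P y = Star PushStep x y

    _<P_ : Bond cl cu Δ → Bond cl cu Δ → Set
    x <P y = (x ≤P y) × ¬ (proj₁ x ≈ proj₁ y)

    Covers : Bond cl cu Δ → Bond cl cu Δ → Set
    Covers x y = (x <P y) × (∀ z → ¬ ((x <P z) × (z <P y)))

    IsPushColouring : (∀ {x y} → Covers x y → Fin n) → Set
    IsPushColouring c = ∀ {x y} (e : Covers x y) →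
      (c e ≢ v₀) × (proj₁ y ≈ push (singleton (c e)) (proj₁ x))

IsUColouring : {X K : Set} (_≈X_ : X → X → Set) (E : X → X → Set) →
               (∀ {x y} → E x y → K) → Set
IsUColouring {X} _≈X_ E c =
  (∀ {u v w} (e₁ : E v u) (e₂ : E v w) → ¬ (u ≈X w) → c e₁ ≢ c e₂)
  × (∀ {u v w} (e₁ : E v u) (e₂ : E v w) → ¬ (u ≈X w) →
       Σ[ z ∈ X ] Σ[ f₁ ∈ E u z ] Σ[ f₂ ∈ E w z ]
         (c e₁ ≡ c f₂) × (c e₂ ≡ c f₁))

-- Write x ⊕ P for the map obtained from x by pushing each vertex t exactly P t times. Then x ≼ y
-- means y = x ⊕ P for some P ≥ 0 with P v₀ = 0, and by connectivity P is determined by x and y.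
-- Consequently push({w}, x) cannot be split into two nontrivial pushes, so it covers x whenever it is
-- a Δ-bond. Conversely, if x ⋖ y with potential P, follow tight arcs (arcs at the bound a push would
-- cross) along which P does not decrease, starting where P ≥ 1: a tight cycle would make its arcs
-- rigid, so the walk stops at a vertex w with P w ≥ 1 for which push({w}, x) is a Δ-bond below y,
-- and the cover forces y = push({w}, x). Finally, two covers push({a}, v) and push({b}, v) with
-- a ≠ b are both covered by push({b}, push({a}, v)), a Δ-bond because on every arc it agrees with
-- v or with one of the two covers.

module Submission where

open import Data.Bool using (Bool; true; false)
open import Data.Empty using (⊥-elim)
open import Data.Fin as Fin using (Fin; _≟_)
import Data.Fin.Properties as Finₚ
open import Data.Integer as ℤ using (ℤ; +_; _+_; _-_; -_; 0ℤ; 1ℤ; -1ℤ; _≤_; +≤+; -≤-)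
import Data.Integer.Properties as ℤₚ
open import Data.Integer.Tactic.RingSolver using (solve-∀)
open import Data.List using (List; []; _∷_; _++_; [_]; map; length; lookup; foldr; allFin)
import Data.List.Properties as Listₚ
open import Data.List.Membership.Propositional using (_∈_; _∉_)
open import Data.List.Membership.Propositional.Properties using (∈-lookup; ∈-map⁺; ∈-allFin)
open import Data.List.Extrema.Nat using (max; xs≤max)
open import Data.List.Relation.Unary.All as All using (All; []; _∷_)
import Data.List.Relation.Unary.All.Properties as Allₚ
open import Data.List.Relation.Unary.Any using (here; there)
open import Data.List.Relation.Unary.Unique.Propositional using (Unique; []; _∷_)
import Data.List.Relation.Unary.Unique.Propositional.Properties as Uniqueₚ
open import Data.Nat as ℕ using (ℕ; zero; suc; z≤n; s≤s)
import Data.Nat.Properties as ℕₚ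
open import Data.Product using (Σ; Σ-syntax; _×_; _,_; proj₁; proj₂)
open import Data.Sum using (_⊎_; inj₁; inj₂)
open import Relation.Binary.Construct.Closure.ReflexiveTransitive using (Star; ε; _◅_)
open import Relation.Binary.PropositionalEquality
  using (_≡_; _≢_; _≗_; refl; sym; trans; cong; cong₂; subst; module ≡-Reasoning)
open import Relation.Nullary using (¬_; Dec; yes; no; _×-dec_)
open import Relation.Unary using (Decidable)
open import Relation.Nullary.Decidable using (dec-true; dec-false; isYes≗does)
open import Function using (_∘_)

open import Algebra.Properties.AbelianGroup ℤₚ.+-0-abelianGroup using (∙-cancelˡ)

import Defs as D
open import Defs
  using (Connected; UAdj; Cycle; mkCycle; Bond; Rigid; _≤P_; _<P_; Covers; IsPushColouring; IsUColouring; _≈_)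

lookup-injective : ∀ {A : Set} {xs : List A} → Unique xs →
                   ∀ {i j} → i Fin.< j → lookup xs i ≢ lookup xs j
lookup-injective (x∉xs ∷ _) {Fin.zero} {Fin.suc j} _ = All.lookup x∉xs (∈-lookup j)
lookup-injective (_ ∷ xs!) {Fin.suc i} {Fin.suc j} (ℕ.s≤s i<j) = lookup-injective xs! i<j

Unique⇒length≤ : ∀ {n} {xs : List (Fin n)} → Unique xs → length xs ℕ.≤ n
Unique⇒length≤ {n} {xs} xs! with length xs ℕ.≤? n
... | yes ≤n = ≤n
... | no ≰n with i , j , i<j , eq ← Finₚ.pigeonhole (ℕₚ.≰⇒> ≰n) (lookup xs) =
  ⊥-elim (lookup-injective xs! i<j eq)

Unique-∷ʳ : ∀ {A : Set} {xs : List A} {y} → Unique xs → y ∉ xs → Unique (xs ++ [ y ])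
Unique-∷ʳ xs! y∉xs = Uniqueₚ.++⁺ xs! ([] ∷ []) λ { (y∈xs , here refl) → y∉xs y∈xs }

length-∷ʳ : ∀ {A : Set} (xs : List A) y → length (xs ++ [ y ]) ≡ suc (length xs)
length-∷ʳ xs y = trans (Listₚ.length-++ xs) (ℕₚ.+-comm (length xs) 1)

bit : Bool → ℕ
bit true  = 1
bit false = 0

positive : ℕ → Bool
positive zero    = false
positive (suc _) = true

shift : Bool → Bool → ℤ
shift b b′ = + bit b - + bit b′

infix 4 _∈[_,_]

_∈[_,_] : ℤ → ℤ → ℤ → Set
z ∈[ l , u ] = l ≤ z × z ≤ u

∈-resp-≡ : ∀ {l u z z′} → z ≡ z′ → z ∈[ l , u ] → z′ ∈[ l , u ]
∈-resp-≡ refl z∈ = z∈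

+0-∈ : ∀ {l u} X → X ∈[ l , u ] → X + 0ℤ ∈[ l , u ]
+0-∈ X = ∈-resp-≡ (sym (ℤₚ.+-identityʳ X))

-- Pushing the vertices of positive potential moves an arc value one unit towards its target value.
positive-shift-∈ : ∀ {l u} X p q → X ∈[ l , u ] → X + (+ p - + q) ∈[ l , u ] →
                   X + shift (positive p) (positive q) ∈[ l , u ]
positive-shift-∈ X zero    zero    X∈       _         = +0-∈ X X∈
positive-shift-∈ X (suc p) (suc q) X∈       _         = +0-∈ X X∈
positive-shift-∈ X (suc p) zero    (l≤X , _) (_ , Y≤u) =
  ℤₚ.≤-trans l≤X (ℤₚ.i≤i+j X 1ℤ) , ℤₚ.≤-trans (ℤₚ.+-monoʳ-≤ X (+≤+ (s≤s z≤n))) Y≤u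
positive-shift-∈ X zero    (suc q) (_ , X≤u) (l≤Y , _) =
  ℤₚ.≤-trans l≤Y (ℤₚ.+-monoʳ-≤ X (-≤- z≤n)) , ℤₚ.≤-trans (ℤₚ.i-j≤i X 1ℤ) X≤u

-- Two pushes at disjoint sets never move an arc value beyond what each of them does alone.
disjoint-shifts-∈ : ∀ {l u} X us ut ws wt → (us ≡ true → ws ≡ false) → (ut ≡ true → wt ≡ false) →
                    X ∈[ l , u ] → X + shift us ut ∈[ l , u ] → X + shift ws wt ∈[ l , u ] →
                    X + shift ws wt + shift us ut ∈[ l , u ]
disjoint-shifts-∈ X true  true  ws    wt    _ _ _  _  W∈ = +0-∈ _ W∈
disjoint-shifts-∈ X false false ws    wt    _ _ _  _  W∈ = +0-∈ _ W∈
disjoint-shifts-∈ X us    ut    true  true  _ _ _  U∈ _  =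
  ∈-resp-≡ (cong (_+ shift us ut) (sym (ℤₚ.+-identityʳ X))) U∈
disjoint-shifts-∈ X us    ut    false false _ _ _  U∈ _  =
  ∈-resp-≡ (cong (_+ shift us ut) (sym (ℤₚ.+-identityʳ X))) U∈
disjoint-shifts-∈ X true  false false true  _ _ X∈ _  _  = ∈-resp-≡ (cancel X) X∈
  where
  cancel : ∀ X → X ≡ X + -1ℤ + 1ℤ
  cancel = solve-∀
disjoint-shifts-∈ X false true  true  false _ _ X∈ _  _  = ∈-resp-≡ (cancel X) X∈
  where
  cancel : ∀ X → X ≡ X + 1ℤ + -1ℤ
  cancel = solve-∀
disjoint-shifts-∈ X true  false true  false U#W _ _ _ _ with () ← U#W refl
disjoint-shifts-∈ X false true  false true  _ U#W _ _ _ with () ← U#W refl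

bit-positive-≤ : ∀ p → bit (positive p) ℕ.≤ p
bit-positive-≤ zero    = z≤n
bit-positive-≤ (suc p) = s≤s z≤n

∸-positive-≤ : ∀ {K} p → p ℕ.≤ suc K → p ℕ.∸ bit (positive p) ℕ.≤ K
∸-positive-≤ zero    _         = z≤n
∸-positive-≤ (suc p) (s≤s p≤K) = p≤K

1≤p-q : ∀ {p q} → q ℕ.< p → 1ℤ ≤ + p - + q
1≤p-q {p} {q} q<p = subst (1ℤ ≤_) (sym (trans (ℤₚ.m-n≡m⊖n p q) (ℤₚ.⊖-≥ (ℕₚ.<⇒≤ q<p))))
                          (+≤+ (ℕₚ.m<n⇒0<n∸m q<p))

p-q≤-1 : ∀ {p q} → p ℕ.< q → + p - + q ≤ -1ℤ
p-q≤-1 {p} {q} p<q = subst (_≤ -1ℤ) (swap (+ q) (+ p)) (ℤₚ.neg-mono-≤ (1≤p-q p<q))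
  where
  swap : ∀ a b → - (a - b) ≡ b - a
  swap = solve-∀

+-≤-≡⇒≡ˡ : ∀ {a b c d : ℤ} → a ≤ b → c ≤ d → a + c ≡ b + d → a ≡ b
+-≤-≡⇒≡ˡ {a} {b} a≤b c≤d eq with a ℤ.≟ b
... | yes a≡b = a≡b
... | no a≢b  = ⊥-elim (ℤₚ.<-irrefl eq (ℤₚ.+-mono-<-≤ (ℤₚ.≤∧≢⇒< a≤b a≢b) c≤d))

module Digraph {n m : ℕ} (src tgt : Fin m → Fin n) where

  open import Data.List.Membership.DecPropositional (_≟_ {n}) using (_∈?_)

  Step : Set
  Step = D.TStep src tgt

  start end : Step → Fin n
  start = D.start src tgt
  end   = D.end src tgt

  Walk : Fin n → List Step → Fin n → Set
  Walk = D.Walk src tgt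

  steps : Cycle src tgt → List Step
  steps = D.steps src tgt

  δ : Cycle src tgt → (Fin m → ℤ) → ℤ
  δ = D.δ src tgt

  push : (Fin n → Bool) → (Fin m → ℤ) → Fin m → ℤ
  push = D.push src tgt

  singleton : Fin n → Fin n → Bool
  singleton = D.singleton src tgt

  walk-∷ʳ : ∀ {u w} ss s → Walk u ss w → start s ≡ w → Walk u (ss ++ [ s ]) (end s)
  walk-∷ʳ []       s refl        refl = refl , refl
  walk-∷ʳ (r ∷ ss) s (r≡u , walk) s≡w = r≡u , walk-∷ʳ ss s walk s≡w

  starts-∷ʳ : ∀ {w} ss s → start s ≡ w → map start (ss ++ [ s ]) ≡ map start ss ++ [ w ]
  starts-∷ʳ ss s refl = Listₚ.map-++ start ss [ s ]

  value : (Fin m → ℤ) → Step → ℤ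
  value x (a , true)  = x a
  value x (a , false) = 0ℤ - x a

  walkSum : (Fin m → ℤ) → List Step → ℤ
  walkSum x []       = 0ℤ
  walkSum x (s ∷ ss) = value x s + walkSum x ss

  foldr≡walkSum : ∀ x {F : Step → ℤ → ℤ} → (∀ s r → F s r ≡ value x s + r) →
                  ∀ ss → foldr F 0ℤ ss ≡ walkSum x ss
  foldr≡walkSum x F≡ []       = refl
  foldr≡walkSum x F≡ (s ∷ ss) = trans (F≡ s _) (cong (λ r → value x s + r) (foldr≡walkSum x F≡ ss))

  -- The summand of δ is local to its definition; splitting off the first step makes it compute.
  δ≡walkSum : ∀ C x → δ C x ≡ walkSum x (steps C)
  δ≡walkSum (mkCycle (a , true)  rest _ _ _) x =
    cong (λ r → x a + r) (foldr≡walkSum x (λ { (_ , true) _ → refl ; (_ , false) _ → refl }) rest)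
  δ≡walkSum (mkCycle (a , false) rest _ _ _) x =
    cong (λ r → 0ℤ - x a + r) (foldr≡walkSum x (λ { (_ , true) _ → refl ; (_ , false) _ → refl }) rest)

  walkSum-cong : ∀ {x y} → x ≗ y → ∀ ss → walkSum x ss ≡ walkSum y ss
  walkSum-cong x≗y []             = refl
  walkSum-cong x≗y ((a , true) ∷ ss)  = cong₂ _+_ (x≗y a) (walkSum-cong x≗y ss)
  walkSum-cong x≗y ((a , false) ∷ ss) = cong₂ (λ p q → 0ℤ - p + q) (x≗y a) (walkSum-cong x≗y ss)

  walkSum-+ : ∀ x y ss → walkSum (λ a → x a + y a) ss ≡ walkSum x ss + walkSum y ss
  walkSum-+ x y []                 = refl
  walkSum-+ x y ((a , true) ∷ ss)  = trans (cong (λ r → x a + y a + r) (walkSum-+ x y ss))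
                                           (interchange (x a) (y a) _ _)
    where
    interchange : ∀ p q r s → p + q + (r + s) ≡ p + r + (q + s)
    interchange = solve-∀
  walkSum-+ x y ((a , false) ∷ ss) = trans (cong (λ r → 0ℤ - (x a + y a) + r) (walkSum-+ x y ss))
                                           (interchange (x a) (y a) _ _)
    where
    interchange : ∀ p q r s → 0ℤ - (p + q) + (r + s) ≡ 0ℤ - p + r + (0ℤ - q + s)
    interchange = solve-∀

  walkSum-mono : ∀ {x y} ss → All (λ s → value x s ≤ value y s) ss → walkSum x ss ≤ walkSum y ss
  walkSum-mono []       []         = ℤₚ.≤-refl
  walkSum-mono (s ∷ ss) (s≤ ∷ ss≤) = ℤₚ.+-mono-≤ s≤ (walkSum-mono ss ss≤)

  value-injective : ∀ {x y} s → value x s ≡ value y s → x (proj₁ s) ≡ y (proj₁ s)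
  value-injective (a , true)  eq = eq
  value-injective (a , false) eq = ℤₚ.neg-injective (∙-cancelˡ 0ℤ _ _ eq)

  ∂ : (Fin n → ℤ) → Fin m → ℤ
  ∂ f a = f (src a) - f (tgt a)

  walkSum-∂ : ∀ f {u v} ss → Walk u ss v → walkSum (∂ f) ss ≡ f u - f v
  walkSum-∂ f {u} []                 refl        = sym (ℤₚ.+-inverseʳ (f u))
  walkSum-∂ f ((a , true) ∷ ss)  (refl , walk) =
    trans (cong (λ r → ∂ f a + r) (walkSum-∂ f ss walk)) (telescope (f (src a)) (f (tgt a)) _)
    where
    telescope : ∀ p q r → p - q + (q - r) ≡ p - r
    telescope = solve-∀
  walkSum-∂ f ((a , false) ∷ ss) (refl , walk) =
    trans (cong (λ r → 0ℤ - ∂ f a + r) (walkSum-∂ f ss walk)) (telescope (f (src a)) (f (tgt a)) _)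
    where
    telescope : ∀ p q r → 0ℤ - (p - q) + (p - r) ≡ q - r
    telescope = solve-∀

  infixl 6 _⊕_

  _⊕_ : (Fin m → ℤ) → (Fin n → ℕ) → Fin m → ℤ
  (x ⊕ P) a = x a + ∂ (λ t → + P t) a

  indicator : (Fin n → Bool) → Fin n → ℕ
  indicator U t = bit (U t)

  push≗⊕indicator : ∀ U x → push U x ≗ x ⊕ indicator U
  push≗⊕indicator U x a with U (src a) | U (tgt a)
  ... | true  | true  = sym (ℤₚ.+-identityʳ (x a))
  ... | true  | false = refl
  ... | false | true  = refl
  ... | false | false = sym (ℤₚ.+-identityʳ (x a))

  δ-cong : ∀ C {x y} → x ≗ y → δ C x ≡ δ C y
  δ-cong C {x} {y} x≗y = trans (δ≡walkSum C x) (trans (walkSum-cong x≗y (steps C)) (sym (δ≡walkSum C y)))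

  δ-⊕ : ∀ C x P → δ C (x ⊕ P) ≡ δ C x
  δ-⊕ C x P = begin
    δ C (x ⊕ P)                                  ≡⟨ δ≡walkSum C (x ⊕ P) ⟩
    walkSum (x ⊕ P) (steps C)                    ≡⟨ walkSum-+ x (∂ P′) (steps C) ⟩
    walkSum x (steps C) + walkSum (∂ P′) (steps C) ≡⟨ cong (λ r → walkSum x (steps C) + r) closed ⟩
    walkSum x (steps C) + 0ℤ                     ≡⟨ ℤₚ.+-identityʳ _ ⟩
    walkSum x (steps C)                          ≡⟨ δ≡walkSum C x ⟨
    δ C x                                        ∎
    where
    open ≡-Reasoning
    P′ : Fin n → ℤ
    P′ t = + P t
    u : Fin n
    u = start (Cycle.first C)
    closed : walkSum (∂ P′) (steps C) ≡ 0ℤ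
    closed = trans (walkSum-∂ P′ (steps C) (Cycle.closed C)) (ℤₚ.+-inverseʳ (P′ u))

  ⊕-congˡ : ∀ {x y} P → x ≗ y → x ⊕ P ≗ y ⊕ P
  ⊕-congˡ P x≗y a = cong (λ r → r + ∂ (λ t → + P t) a) (x≗y a)

  ⊕-congʳ : ∀ x {P Q} → P ≗ Q → x ⊕ P ≗ x ⊕ Q
  ⊕-congʳ x P≗Q a = cong₂ (λ p q → x a + (+ p - + q)) (P≗Q (src a)) (P≗Q (tgt a))

  ⊕-zero : ∀ x {P} → (∀ t → P t ≡ 0) → x ⊕ P ≗ x
  ⊕-zero x P≗0 a = trans (⊕-congʳ x P≗0 a) (ℤₚ.+-identityʳ (x a))

  ⊕-assoc : ∀ x P Q → x ⊕ P ⊕ Q ≗ x ⊕ (λ t → P t ℕ.+ Q t)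
  ⊕-assoc x P Q a = begin
    x a + (+ P s - + P t) + (+ Q s - + Q t)    ≡⟨ regroup (x a) (+ P s) (+ P t) (+ Q s) (+ Q t) ⟩
    x a + ((+ P s + + Q s) - (+ P t + + Q t)) ≡⟨ cong₂ (λ p q → x a + (p - q)) (ℤₚ.pos-+ (P s) (Q s))
                                                                              (ℤₚ.pos-+ (P t) (Q t)) ⟨
    x a + (+ (P s ℕ.+ Q s) - + (P t ℕ.+ Q t)) ∎
    where
    open ≡-Reasoning
    s t : Fin n
    s = src a
    t = tgt a
    regroup : ∀ x p p′ q q′ → x + (p - p′) + (q - q′) ≡ x + ((p + q) - (p′ + q′))
    regroup = solve-∀

  ⊕-peel : ∀ U x P → (∀ t → indicator U t ℕ.≤ P t) →
           push U x ⊕ (λ t → P t ℕ.∸ indicator U t) ≗ x ⊕ P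
  ⊕-peel U x P U≤P a = begin
    (push U x ⊕ P′) a                    ≡⟨ ⊕-congˡ P′ (push≗⊕indicator U x) a ⟩
    (x ⊕ indicator U ⊕ P′) a             ≡⟨ ⊕-assoc x (indicator U) P′ a ⟩
    (x ⊕ (λ t → indicator U t ℕ.+ P′ t)) a ≡⟨ ⊕-congʳ x (λ t → ℕₚ.m+[n∸m]≡n (U≤P t)) a ⟩
    (x ⊕ P) a                            ∎
    where
    open ≡-Reasoning
    P′ : Fin n → ℕ
    P′ t = P t ℕ.∸ indicator U t

  push-cong : ∀ U {x y} → x ≗ y → push U x ≗ push U y
  push-cong U {x} {y} x≗y a =
    trans (push≗⊕indicator U x a) (trans (⊕-congˡ (indicator U) x≗y a) (sym (push≗⊕indicator U y a)))

  push-push : ∀ U W x → push U (push W x) ≗ x ⊕ (λ t → indicator W t ℕ.+ indicator U t)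
  push-push U W x a = trans (push≗⊕indicator U (push W x) a)
                            (trans (⊕-congˡ (indicator U) (push≗⊕indicator W x) a)
                                   (⊕-assoc x (indicator W) (indicator U) a))

  push-comm : ∀ U W x → push U (push W x) ≗ push W (push U x)
  push-comm U W x a = trans (push-push U W x a)
                            (trans (⊕-congʳ x (λ t → ℕₚ.+-comm (indicator W t) (indicator U t)) a)
                                   (sym (push-push W U x a)))

  ∂-constant : ∀ f → (∀ a → ∂ f a ≡ 0ℤ) → ∀ {u v} → Star (UAdj src tgt) u v → f u ≡ f v
  ∂-constant f ∂f≡0 ε                                = refl
  ∂-constant f ∂f≡0 ((a , inj₁ (refl , refl)) ◅ path) =
    trans (ℤₚ.i-j≡0⇒i≡j _ _ (∂f≡0 a)) (∂-constant f ∂f≡0 path)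
  ∂-constant f ∂f≡0 ((a , inj₂ (refl , refl)) ◅ path) =
    trans (sym (ℤₚ.i-j≡0⇒i≡j _ _ (∂f≡0 a))) (∂-constant f ∂f≡0 path)

  ⊕-injective : Connected src tgt → ∀ v₀ x {P Q} → x ⊕ P ≗ x ⊕ Q → P v₀ ≡ Q v₀ → P ≗ Q
  ⊕-injective connected v₀ x {P} {Q} eq P₀≡Q₀ t =
    ℤₚ.+-injective (ℤₚ.i-j≡0⇒i≡j _ _ (trans (∂-constant d ∂d≡0 (connected t v₀))
                                              (ℤₚ.i≡j⇒i-j≡0 (cong +_ P₀≡Q₀))))
    where
    d : Fin n → ℤ
    d t = + P t - + Q t
    rearrange : ∀ p q p′ q′ → (p - q) - (p′ - q′) ≡ (p - p′) - (q - q′)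
    rearrange = solve-∀
    ∂d≡0 : ∀ a → ∂ d a ≡ 0ℤ
    ∂d≡0 a = trans (rearrange (+ P (src a)) (+ Q (src a)) (+ P (tgt a)) (+ Q (tgt a)))
                   (ℤₚ.i≡j⇒i-j≡0 (∙-cancelˡ (x a) _ _ (eq a)))

  singleton-self : ∀ w → singleton w w ≡ true
  singleton-self w = trans (isYes≗does (w ≟ w)) (dec-true (w ≟ w) refl)

  singleton-≢ : ∀ {t w} → t ≢ w → singleton w t ≡ false
  singleton-≢ {t} {w} t≢w = trans (isYes≗does (t ≟ w)) (dec-false (t ≟ w) t≢w)

  indicator-singleton-self : ∀ w → indicator (singleton w) w ≡ 1
  indicator-singleton-self w = cong bit (singleton-self w)

  indicator-singleton-≢ : ∀ {t w} → t ≢ w → indicator (singleton w) t ≡ 0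
  indicator-singleton-≢ t≢w = cong bit (singleton-≢ t≢w)

  singleton-disjoint : ∀ {v w} t → v ≢ w → singleton v t ≡ true → singleton w t ≡ false
  singleton-disjoint {v} t v≢w t∈v with t ≟ v
  ... | yes refl = singleton-≢ v≢w

  indicator-singleton-injective : ∀ {v w} → indicator (singleton v) ≗ indicator (singleton w) → v ≡ w
  indicator-singleton-injective {v} {w} eq with v ≟ w
  ... | yes v≡w = v≡w
  ... | no v≢w with () ← trans (sym (indicator-singleton-≢ (v≢w ∘ sym)))
                                (trans (eq w) (indicator-singleton-self w))

  indicator-singleton-≤ : ∀ {w} {P : Fin n → ℕ} → 1 ℕ.≤ P w →
                          ∀ t → indicator (singleton w) t ℕ.≤ P t
  indicator-singleton-≤ {w} 1≤Pw t with t ≟ w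
  ... | yes refl = 1≤Pw
  ... | no _     = z≤n

  indicator-split : ∀ {w} (P Q : Fin n → ℕ) → (∀ t → P t ℕ.+ Q t ≡ indicator (singleton w) t) →
                    (∀ t → P t ≡ 0) ⊎ (∀ t → Q t ≡ 0)
  indicator-split {w} P Q sum with P w in Pw
  ... | zero  = inj₁ P≗0
    where
    P≗0 : ∀ t → P t ≡ 0
    P≗0 t with t ≟ w
    ... | yes refl = Pw
    ... | no t≢w   = ℕₚ.m+n≡0⇒m≡0 (P t) (trans (sum t) (indicator-singleton-≢ t≢w))
  ... | suc k = inj₂ Q≗0
    where
    Q≗0 : ∀ t → Q t ≡ 0
    Q≗0 t with t ≟ w
    ... | yes refl = ℕₚ.m+n≡0⇒n≡0 k (ℕₚ.suc-injective
                       (trans (cong (ℕ._+ Q t) (sym Pw)) (trans (sum t) (indicator-singleton-self t))))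
    ... | no t≢w   = ℕₚ.m+n≡0⇒n≡0 (P t) (trans (sum t) (indicator-singleton-≢ t≢w))

  any-step? : ∀ {P : Step → Set} → Decidable P → Dec (Σ Step P)
  any-step? P? with Finₚ.any? (λ a → P? (a , true)) | Finₚ.any? (λ a → P? (a , false))
  ... | yes (a , p) | _           = yes ((a , true) , p)
  ... | no _        | yes (a , p) = yes ((a , false) , p)
  ... | no ¬fwd     | no ¬bwd     = no λ { ((a , true) , p) → ¬fwd (a , p) ; ((a , false) , p) → ¬bwd (a , p) }

  -- The search extends a simple walk of Good steps until it is stuck or revisits a vertex, which
  -- closes a Good cycle; simplicity bounds its length by n.
  module SinkSearch (Good : Step → Set) (good? : Decidable Good)
                    (good-by-arc : ∀ {s s′} → Good s → Good s′ → proj₁ s ≡ proj₁ s′ → s ≡ s′)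
                    (Q : Fin n → Set) (Q-good : ∀ {s} → Good s → Q (start s) → Q (end s)) where

    Sink : Fin n → Set
    Sink w = ∀ s → start s ≡ w → ¬ Good s

    GoodCycle : Set
    GoodCycle = Σ[ C ∈ Cycle src tgt ] All Good (steps C)

    arcs-unique : ∀ {ss} → All Good ss → Unique (map start ss) → Unique (map proj₁ ss)
    arcs-unique []       []           = []
    arcs-unique (g ∷ gs) (s∉ss ∷ ss!) =
      Allₚ.map⁺ (All.zipWith (λ (g′ , ≢) eq → ≢ (cong start (good-by-arc g g′ eq)))
                             (gs , Allₚ.map⁻ s∉ss))
      ∷ arcs-unique gs ss!

    closed⇒cycle : ∀ {u} s ss → Walk u (s ∷ ss) u → All Good (s ∷ ss) → Unique (map start (s ∷ ss)) →
                   GoodCycle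
    closed⇒cycle s ss (refl , walk) good distinct =
      mkCycle s ss (refl , walk) distinct (arcs-unique good distinct) , good

    close : ∀ {w} rs s → Walk (end s) rs w → start s ≡ w → All Good rs → Good s →
            Unique (map start rs ++ [ w ]) → GoodCycle
    close []       s walk s≡w good g distinct =
      closed⇒cycle s [] (walk-∷ʳ [] s walk s≡w) (g ∷ []) ([] ∷ [])
    close (r ∷ rs) s walk s≡w good g distinct =
      closed⇒cycle r (rs ++ [ s ]) (walk-∷ʳ (r ∷ rs) s walk s≡w) (Allₚ.++⁺ good (g ∷ []))
                   (subst Unique (sym (starts-∷ʳ (r ∷ rs) s s≡w)) distinct)

    close-at : ∀ {u w} ss → Walk u ss w → All Good ss → Unique (map start ss ++ [ w ]) →
               ∀ s → start s ≡ w → Good s → end s ∈ map start ss ++ [ w ] → GoodCycle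
    close-at []       _          good       distinct       s s≡w g (here e)   = close [] s e s≡w good g distinct
    close-at []       _          _          _              _ _   _ (there ())
    close-at (r ∷ rs) (_ , walk) good       distinct       s s≡w g (here e)   =
      close (r ∷ rs) s (sym e , walk) s≡w good g distinct
    close-at (r ∷ rs) (_ , walk) (_ ∷ good) (_ ∷ distinct) s s≡w g (there e∈) =
      close-at rs walk good distinct s s≡w g e∈

    search : ∀ k {u w} ss → k ℕ.+ length ss ≡ n → Walk u ss w → All Good ss →
             Unique (map start ss ++ [ w ]) → Q w → (Σ[ w ∈ Fin n ] Q w × Sink w) ⊎ GoodCycle
    search zero {w = w} ss len _ _ distinct _ =
      ⊥-elim (ℕₚ.<-irrefl len (subst (ℕ._≤ n) visited (Unique⇒length≤ distinct)))
      where
      visited : length (map start ss ++ [ w ]) ≡ suc (length ss)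
      visited = trans (length-∷ʳ (map start ss) w) (cong suc (Listₚ.length-map start ss))
    search (suc k) {w = w} ss len walk good distinct qw with any-step? (λ s → start s ≟ w ×-dec good? s)
    ... | no none = inj₁ (w , qw , λ s s≡w g → none (s , s≡w , g))
    ... | yes (s , s≡w , g) with end s ∈? map start ss ++ [ w ]
    ...   | yes visited = inj₂ (close-at ss walk good distinct s s≡w g visited)
    ...   | no fresh    = search k (ss ++ [ s ]) len′ (walk-∷ʳ ss s walk s≡w) (Allₚ.++⁺ good (g ∷ []))
                                 distinct′ (Q-good g (subst Q (sym s≡w) qw))
      where
      len′ : k ℕ.+ length (ss ++ [ s ]) ≡ n
      len′ = trans (cong (k ℕ.+_) (length-∷ʳ ss s)) (trans (ℕₚ.+-suc k (length ss)) len)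
      distinct′ : Unique (map start (ss ++ [ s ]) ++ [ end s ])
      distinct′ = subst (λ vs → Unique (vs ++ [ end s ])) (sym (starts-∷ʳ ss s s≡w))
                        (Unique-∷ʳ distinct fresh)

    sink-or-cycle : ∀ {t} → Q t → (Σ[ w ∈ Fin n ] Q w × Sink w) ⊎ GoodCycle
    sink-or-cycle qt = search n [] (ℕₚ.+-identityʳ n) refl [] ([] ∷ []) qt

module BondPoset {n m : ℕ} (src tgt : Fin m → Fin n) (connected : Connected src tgt)
                 (cl cu : Fin m → ℤ) (Δ : Cycle src tgt → ℤ) (v₀ : Fin n) where

  open Digraph src tgt

  ΔBond : Set
  ΔBond = Bond src tgt cl cu Δ

  infix 4 _≼_ _≺_ _⋖_

  _≼_ _≺_ _⋖_ : ΔBond → ΔBond → Set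
  _≼_ = _≤P_ src tgt cl cu Δ v₀
  _≺_ = _<P_ src tgt cl cu Δ v₀
  _⋖_ = Covers src tgt cl cu Δ v₀

  InBounds : (Fin m → ℤ) → Set
  InBounds z = ∀ a → z a ∈[ cl a , cu a ]

  pushBond : (x : ΔBond) (U : Fin n → Bool) → InBounds (push U (proj₁ x)) → ΔBond
  pushBond (x , _ , x-cycles) U inBounds =
    push U x , inBounds ,
    λ C → trans (δ-cong C (push≗⊕indicator U x)) (trans (δ-⊕ C x (indicator U)) (x-cycles C))

  Potential : (x y : Fin m → ℤ) → (Fin n → ℕ) → Set
  Potential x y P = P v₀ ≡ 0 × y ≗ x ⊕ P

  ≼⇒potential : ∀ {x y} → x ≼ y → Σ[ P ∈ (Fin n → ℕ) ] Potential (proj₁ x) (proj₁ y) P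
  ≼⇒potential {x , _} ε = (λ _ → 0) , refl , λ a → sym (⊕-zero x (λ _ → refl) a)
  ≼⇒potential {x , _} ((U , U₀ , x₁≗) ◅ x₁≼y) with ≼⇒potential x₁≼y
  ... | Q , Q₀ , y≗ = (λ t → indicator U t ℕ.+ Q t) , cong₂ (λ b q → bit b ℕ.+ q) U₀ Q₀ ,
                      λ a → trans (y≗ a) (trans (⊕-congˡ Q x₁≗ a)
                                  (trans (⊕-congˡ Q (push≗⊕indicator U x) a) (⊕-assoc x (indicator U) Q a)))

  bounded-potential⇒≼ : ∀ K {x y : ΔBond} {P} → (∀ t → P t ℕ.≤ K) →
                        Potential (proj₁ x) (proj₁ y) P → x ≼ y
  -- y ≗ x does not make y ≡ x, so the chain of pushes ends with a push at the empty set.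
  bounded-potential⇒≼ zero {x , _} {P = P} P≤0 (_ , y≗) =
    ((λ _ → false) , refl , λ a → trans (y≗ a) (⊕-zero x (λ t → ℕₚ.n≤0⇒n≡0 (P≤0 t)) a)) ◅ ε
  bounded-potential⇒≼ (suc K) {x , x-bond} {y , y-bond} {P} P≤K (P₀ , y≗) =
    (U , cong positive P₀ , λ _ → refl) ◅ bounded-potential⇒≼ K {x₁} P′≤K (P′₀ , y≗x₁⊕P′)
    where
    U : Fin n → Bool
    U t = positive (P t)
    x₁ : ΔBond
    x₁ = pushBond (x , x-bond) U λ a →
      ∈-resp-≡ (sym (push≗⊕indicator U x a))
               (positive-shift-∈ (x a) (P (src a)) (P (tgt a))
                                 (proj₁ x-bond a) (∈-resp-≡ (y≗ a) (proj₁ y-bond a)))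
    P′ : Fin n → ℕ
    P′ t = P t ℕ.∸ indicator U t
    P′≤K : ∀ t → P′ t ℕ.≤ K
    P′≤K t = ∸-positive-≤ (P t) (P≤K t)
    P′₀ : P′ v₀ ≡ 0
    P′₀ = cong (λ p → p ℕ.∸ bit (positive p)) P₀
    y≗x₁⊕P′ : y ≗ proj₁ x₁ ⊕ P′
    y≗x₁⊕P′ a = trans (y≗ a) (sym (⊕-peel U x P (λ t → bit-positive-≤ (P t)) a))

  potential⇒≼ : ∀ {x y : ΔBond} {P} → Potential (proj₁ x) (proj₁ y) P → x ≼ y
  potential⇒≼ {P = P} =
    bounded-potential⇒≼ (max 0 Ps) λ t → All.lookup (xs≤max 0 Ps) (∈-map⁺ P (∈-allFin t))
    where
    Ps : List ℕ
    Ps = map P (allFin n)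

  singleton-v₀ : ∀ {w} → w ≢ v₀ → singleton w v₀ ≡ false
  singleton-v₀ w≢v₀ = singleton-≢ (w≢v₀ ∘ sym)

  push-singleton-≉ : ∀ {w} x → w ≢ v₀ → ¬ (x ≗ push (singleton w) x)
  push-singleton-≉ {w} x w≢v₀ x≗ = ℕₚ.1+n≢0 (trans (sym (indicator-singleton-self w))
                                             (⊕-injective connected v₀ x eq (cong bit (singleton-v₀ w≢v₀)) w))
    where
    eq : x ⊕ indicator (singleton w) ≗ x ⊕ (λ _ → 0)
    eq a = trans (sym (push≗⊕indicator (singleton w) x a)) (trans (sym (x≗ a)) (sym (⊕-zero x (λ _ → refl) a)))

  push-singleton-injective : ∀ x {v w} → v ≢ v₀ → w ≢ v₀ →
                             push (singleton v) x ≗ push (singleton w) x → v ≡ w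
  push-singleton-injective x {v} {w} v≢v₀ w≢v₀ pushes≗ =
    indicator-singleton-injective (⊕-injective connected v₀ x eq
      (trans (cong bit (singleton-v₀ v≢v₀)) (sym (cong bit (singleton-v₀ w≢v₀)))))
    where
    eq : x ⊕ indicator (singleton v) ≗ x ⊕ indicator (singleton w)
    eq a = trans (sym (push≗⊕indicator (singleton v) x a))
                 (trans (pushes≗ a) (push≗⊕indicator (singleton w) x a))

  push-singleton-unsplittable : ∀ {w x z y P Q} → w ≢ v₀ → Potential x z P → Potential z y Q →
                                y ≗ push (singleton w) x → (∀ t → P t ≡ 0) ⊎ (∀ t → Q t ≡ 0)
  push-singleton-unsplittable {w} {x} {P = P} {Q} w≢v₀ (P₀ , z≗) (Q₀ , y≗) y≗push =
    indicator-split P Q (⊕-injective connected v₀ x eq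
                          (trans (cong₂ ℕ._+_ P₀ Q₀) (sym (cong bit (singleton-v₀ w≢v₀)))))
    where
    eq : x ⊕ (λ t → P t ℕ.+ Q t) ≗ x ⊕ indicator (singleton w)
    eq a = trans (sym (⊕-assoc x P Q a)) (trans (⊕-congˡ Q (λ a → sym (z≗ a)) a)
                 (trans (sym (y≗ a)) (trans (y≗push a) (push≗⊕indicator (singleton w) x a))))

  push-singleton-⋖ : ∀ {w} (x y : ΔBond) → w ≢ v₀ → proj₁ y ≗ push (singleton w) (proj₁ x) → x ⋖ y
  push-singleton-⋖ {w} x y w≢v₀ y≗ =
    (((singleton w , singleton-v₀ w≢v₀ , y≗) ◅ ε) , x≉y) , nothing-between
    where
    x≉y : ¬ (proj₁ x ≗ proj₁ y)
    x≉y x≗y = push-singleton-≉ (proj₁ x) w≢v₀ (λ a → trans (x≗y a) (y≗ a))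
    nothing-between : ∀ z → ¬ (x ≺ z × z ≺ y)
    nothing-between z ((x≼z , x≉z) , (z≼y , z≉y))
      with P , P₀ , z≗ ← ≼⇒potential x≼z | Q , Q₀ , y≗z⊕Q ← ≼⇒potential z≼y
      with push-singleton-unsplittable {P = P} {Q} w≢v₀ (P₀ , z≗) (Q₀ , y≗z⊕Q) y≗
    ... | inj₁ P≗0 = x≉z λ a → sym (trans (z≗ a) (⊕-zero (proj₁ x) P≗0 a))
    ... | inj₂ Q≗0 = z≉y λ a → sym (trans (y≗z⊕Q a) (⊕-zero (proj₁ z) Q≗0 a))

  module Tightness (x : ΔBond) where

    X : Fin m → ℤ
    X = proj₁ x

    X∈ : InBounds X
    X∈ = proj₁ (proj₂ x)

    -- A step is tight if x already sits at the bound that pushing its start vertex would cross.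
    Tight : Step → Set
    Tight (a , true)  = X a ≡ cu a
    Tight (a , false) = X a ≡ cl a

    tight? : Decidable Tight
    tight? (a , true)  = X a ℤ.≟ cu a
    tight? (a , false) = X a ℤ.≟ cl a

    value-≤-tight : ∀ (z : ΔBond) s → Tight s → value (proj₁ z) s ≤ value X s
    value-≤-tight (z , z∈ , _) (a , true)  X≡cu = subst (z a ≤_) (sym X≡cu) (proj₂ (z∈ a))
    value-≤-tight (z , z∈ , _) (a , false) X≡cl =
      ℤₚ.+-monoʳ-≤ 0ℤ (ℤₚ.neg-mono-≤ (subst (_≤ z a) (sym X≡cl) (proj₁ (z∈ a))))

    -- Every Δ-bond has the same δ on a cycle; on a tight cycle this forces it to agree with x.
    tight-cycle-rigid : ∀ C → All Tight (steps C) → Rigid src tgt cl cu Δ (proj₁ (Cycle.first C))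
    tight-cycle-rigid C (tight₁ ∷ tight) z z′ = trans (agrees z) (sym (agrees z′))
      where
      s₁ : Step
      s₁ = Cycle.first C
      agrees : ∀ (z : ΔBond) → proj₁ z (proj₁ s₁) ≡ X (proj₁ s₁)
      agrees (z , z-bond) = value-injective s₁ (+-≤-≡⇒≡ˡ
        (value-≤-tight (z , z-bond) s₁ tight₁)
        (walkSum-mono (Cycle.rest C) (All.map (λ {s} → value-≤-tight (z , z-bond) s) tight))
        (trans (sym (δ≡walkSum C z))
               (trans (proj₂ z-bond C) (trans (sym (proj₂ (proj₂ x) C)) (δ≡walkSum C X)))))

    pinned-rigid : ∀ {a} → X a ≡ cl a → X a ≡ cu a → Rigid src tgt cl cu Δ a
    pinned-rigid {a} X≡cl X≡cu z z′ = trans (squeezed z) (sym (squeezed z′))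
      where
      squeezed : ∀ (z : ΔBond) → proj₁ z a ≡ X a
      squeezed (z , z∈ , _) = ℤₚ.≤-antisym (subst (z a ≤_) (sym X≡cu) (proj₂ (z∈ a)))
                                          (subst (_≤ z a) (sym X≡cl) (proj₁ (z∈ a)))

  module Descent (nonrigid : ∀ a → ¬ Rigid src tgt cl cu Δ a) {x y : ΔBond} {P : Fin n → ℕ}
                 (potential : Potential (proj₁ x) (proj₁ y) P) where

    open Tightness x

    Blocking : Step → Set
    Blocking s = Tight s × P (start s) ℕ.≤ P (end s)

    tight-by-arc : ∀ {s s′} → Tight s → Tight s′ → proj₁ s ≡ proj₁ s′ → s ≡ s′
    tight-by-arc {a , true}  {.a , true}  _     _     refl = refl
    tight-by-arc {a , false} {.a , false} _     _     refl = refl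
    tight-by-arc {a , true}  {.a , false} X≡cu  X≡cl  refl = ⊥-elim (nonrigid a (pinned-rigid X≡cl X≡cu))
    tight-by-arc {a , false} {.a , true}  X≡cl  X≡cu  refl = ⊥-elim (nonrigid a (pinned-rigid X≡cl X≡cu))

    open SinkSearch Blocking (λ s → tight? s ×-dec P (start s) ℕ.≤? P (end s))
                    (λ (t , _) (t′ , _) → tight-by-arc t t′)
                    (λ w → 1 ℕ.≤ P w) (λ (_ , P≤P) 1≤P → ℕₚ.≤-trans 1≤P P≤P)

    Y∈ : InBounds (proj₁ y)
    Y∈ = proj₁ (proj₂ y)

    sink-push-inBounds : ∀ {w} → Sink w → InBounds (push (singleton w) X)
    sink-push-inBounds {w} sink a with src a ≟ w | tgt a ≟ w
    ... | yes _    | yes _    = X∈ a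
    ... | no _     | no _     = X∈ a
    ... | yes refl | no _     = ℤₚ.≤-trans (proj₁ (X∈ a)) (ℤₚ.i≤i+j (X a) 1ℤ) , forward
      where
      forward : X a + 1ℤ ≤ cu a
      forward with P (src a) ℕ.≤? P (tgt a)
      ... | yes ascending  = subst (_≤ cu a) (ℤₚ.+-comm 1ℤ (X a))
                                   (ℤₚ.i<j⇒suc[i]≤j (ℤₚ.≤∧≢⇒< (proj₂ (X∈ a))
                                      λ tight → sink (a , true) refl (tight , ascending)))
      ... | no descending = ℤₚ.≤-trans (ℤₚ.+-monoʳ-≤ (X a) (1≤p-q (ℕₚ.≰⇒> descending)))
                                       (subst (_≤ cu a) (proj₂ potential a) (proj₂ (Y∈ a)))
    ... | no _     | yes refl = backward , ℤₚ.≤-trans (ℤₚ.i-j≤i (X a) 1ℤ) (proj₂ (X∈ a))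
      where
      backward : cl a ≤ X a - 1ℤ
      backward with P (tgt a) ℕ.≤? P (src a)
      ... | yes ascending  = subst (cl a ≤_) (ℤₚ.+-comm -1ℤ (X a))
                                   (ℤₚ.i<j⇒i≤pred[j] (ℤₚ.≤∧≢⇒< (proj₁ (X∈ a))
                                      λ tight → sink (a , false) refl (sym tight , ascending)))
      ... | no descending = ℤₚ.≤-trans (subst (cl a ≤_) (proj₂ potential a) (proj₁ (Y∈ a)))
                                       (ℤₚ.+-monoʳ-≤ (X a) (p-q≤-1 (ℕₚ.≰⇒> descending)))

    positive-≢v₀ : ∀ {w} → 1 ℕ.≤ P w → w ≢ v₀
    positive-≢v₀ 1≤Pw refl = ℕₚ.n≮0 (subst (1 ℕ.≤_) (proj₁ potential) 1≤Pw)

    module _ {w} (1≤Pw : 1 ℕ.≤ P w) (sink : Sink w) where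

      pushed : ΔBond
      pushed = pushBond x (singleton w) (sink-push-inBounds sink)

      x≺pushed : x ≺ pushed
      x≺pushed = ((singleton w , singleton-v₀ (positive-≢v₀ 1≤Pw) , λ _ → refl) ◅ ε) ,
                 push-singleton-≉ X (positive-≢v₀ 1≤Pw)

      pushed≼y : pushed ≼ y
      pushed≼y = potential⇒≼ {pushed} {y} {λ t → P t ℕ.∸ indicator (singleton w) t}
        (P₀′ , λ a → trans (proj₂ potential a) (sym (⊕-peel (singleton w) X P (indicator-singleton-≤ 1≤Pw) a)))
        where
        P₀′ : P v₀ ℕ.∸ indicator (singleton w) v₀ ≡ 0
        P₀′ = trans (cong (ℕ._∸ indicator (singleton w) v₀) (proj₁ potential))
                    (ℕₚ.0∸n≡0 (indicator (singleton w) v₀))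

    -- A single arc where pushed and y differ would put pushed strictly between x and y.
    covered-by-sink : (∀ z → ¬ (x ≺ z × z ≺ y)) → ∀ {w} → 1 ℕ.≤ P w → Sink w →
                      proj₁ y ≗ push (singleton w) X
    covered-by-sink nothing-between 1≤Pw sink a with proj₁ (pushed 1≤Pw sink) a ℤ.≟ proj₁ y a
    ... | yes z≡y = sym z≡y
    ... | no z≢y  =
      ⊥-elim (nothing-between _ (x≺pushed 1≤Pw sink , pushed≼y 1≤Pw sink , λ z≗y → z≢y (z≗y a)))

    covered⇒push-singleton : ¬ (X ≗ proj₁ y) → (∀ z → ¬ (x ≺ z × z ≺ y)) →
                             Σ[ w ∈ Fin n ] w ≢ v₀ × proj₁ y ≗ push (singleton w) X
    covered⇒push-singleton x≉y nothing-between with Finₚ.any? (λ t → 1 ℕ.≤? P t)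
    ... | no P≗0 = ⊥-elim (x≉y λ a → sym (trans (proj₂ potential a)
                     (⊕-zero X (λ t → ℕₚ.n<1⇒n≡0 (ℕₚ.≰⇒> λ 1≤Pt → P≗0 (t , 1≤Pt))) a)))
    ... | yes (_ , 1≤P) with sink-or-cycle 1≤P
    ...   | inj₁ (w , 1≤Pw , sink) = w , positive-≢v₀ 1≤Pw , covered-by-sink nothing-between 1≤Pw sink
    ...   | inj₂ (C , blocking)    = ⊥-elim (nonrigid _ (tight-cycle-rigid C (All.map proj₁ blocking)))

  ⋖⇒push-singleton : (∀ a → ¬ Rigid src tgt cl cu Δ a) → ∀ {x y} → x ⋖ y →
                     Σ[ w ∈ Fin n ] w ≢ v₀ × proj₁ y ≗ push (singleton w) (proj₁ x)
  ⋖⇒push-singleton nonrigid ((x≼y , x≉y) , nothing-between) with P , potential ← ≼⇒potential x≼y =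
    Descent.covered⇒push-singleton nonrigid {P = P} potential x≉y nothing-between

  module _ (c : ∀ {x y} → x ⋖ y → Fin n) (c-push : IsPushColouring src tgt cl cu Δ v₀ c) where

    push-colouring-injective : ∀ {u v w} (e₁ : v ⋖ u) (e₂ : v ⋖ w) → ¬ (proj₁ u ≗ proj₁ w) →
                               c e₁ ≢ c e₂
    push-colouring-injective {v = v} e₁ e₂ u≉w c₁≡c₂ = u≉w λ a →
      trans (proj₂ (c-push e₁) a)
            (trans (cong (λ t → push (singleton t) (proj₁ v) a) c₁≡c₂) (sym (proj₂ (c-push e₂) a)))

    push-colouring-square : ∀ {u v w} (e₁ : v ⋖ u) (e₂ : v ⋖ w) → ¬ (proj₁ u ≗ proj₁ w) →
                            Σ[ z ∈ ΔBond ] Σ[ f₁ ∈ u ⋖ z ] Σ[ f₂ ∈ w ⋖ z ] (c e₁ ≡ c f₂) × (c e₂ ≡ c f₁)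
    push-colouring-square {u} {v , v-bond} {w} e₁ e₂ u≉w =
      z , f₁ , f₂ ,
      sym (push-singleton-injective (proj₁ w) (proj₁ (c-push f₂)) a≢v₀
                                    λ e → trans (sym (proj₂ (c-push f₂) e)) (z≗ e)) ,
      sym (push-singleton-injective (proj₁ u) (proj₁ (c-push f₁)) b≢v₀ λ e → sym (proj₂ (c-push f₁) e))
      where
      a b : Fin n
      a = c e₁
      b = c e₂
      a≢v₀ : a ≢ v₀
      a≢v₀ = proj₁ (c-push e₁)
      b≢v₀ : b ≢ v₀
      b≢v₀ = proj₁ (c-push e₂)
      a≢b : a ≢ b
      a≢b = push-colouring-injective e₁ e₂ u≉w
      u≗ : proj₁ u ≗ push (singleton a) v
      u≗ = proj₂ (c-push e₁)
      w≗ : proj₁ w ≗ push (singleton b) v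
      w≗ = proj₂ (c-push e₂)
      pushed-twice : push (singleton b) (proj₁ u) ≗ v ⊕ indicator (singleton a) ⊕ indicator (singleton b)
      pushed-twice e = trans (push-cong (singleton b) u≗ e)
                             (trans (push≗⊕indicator (singleton b) _ e)
                                    (⊕-congˡ (indicator (singleton b)) (push≗⊕indicator (singleton a) v) e))
      z : ΔBond
      z = pushBond u (singleton b) λ e →
        ∈-resp-≡ (sym (pushed-twice e))
          (disjoint-shifts-∈ (v e) _ _ _ _
             (singleton-disjoint (src e) (a≢b ∘ sym))
             (singleton-disjoint (tgt e) (a≢b ∘ sym))
             (proj₁ v-bond e)
             (∈-resp-≡ (trans (w≗ e) (push≗⊕indicator (singleton b) v e)) (proj₁ (proj₂ w) e))
             (∈-resp-≡ (trans (u≗ e) (push≗⊕indicator (singleton a) v e)) (proj₁ (proj₂ u) e)))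
      z≗ : proj₁ z ≗ push (singleton a) (proj₁ w)
      z≗ e = trans (push-cong (singleton b) u≗ e)
                   (trans (push-comm (singleton b) (singleton a) v e) (sym (push-cong (singleton a) w≗ e)))
      f₁ : u ⋖ z
      f₁ = push-singleton-⋖ u z b≢v₀ λ _ → refl
      f₂ : w ⋖ z
      f₂ = push-singleton-⋖ w z a≢v₀ z≗

lemma10 : {n m : ℕ} (src tgt : Fin m → Fin n) →
    Connected src tgt →
    (cl cu : Fin m → ℤ) (Δ : Cycle src tgt → ℤ) →
    Bond src tgt cl cu Δ →
    (∀ a → ¬ Rigid src tgt cl cu Δ a) →
    (v₀ : Fin n) →
    Σ (∀ {x y} → Covers src tgt cl cu Δ v₀ x y → Fin n)
      (IsPushColouring src tgt cl cu Δ v₀)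
    × (∀ (c : ∀ {x y} → Covers src tgt cl cu Δ v₀ x y → Fin n) →
         IsPushColouring src tgt cl cu Δ v₀ c →
         IsUColouring (λ x y → _≈_ src tgt (proj₁ x) (proj₁ y))
           (Covers src tgt cl cu Δ v₀) c)
lemma10 src tgt connected cl cu Δ _ nonrigid v₀ =
  ((λ e → proj₁ (⋖⇒push-singleton nonrigid e)) , (λ e → proj₂ (⋖⇒push-singleton nonrigid e))) ,
  λ c c-push → push-colouring-injective c c-push , push-colouring-square c c-push
  where open BondPoset src tgt connected cl cu Δ v₀
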